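{- Let $G$ be a graph and let $P\subseteq V(G)$. A layering $\lambda$ of $G[P]$ extends to a layering of $G$ if and only if $\lambda$ is $G$-geodesic.
   Context: A layering of a graph $H$ is a function $\lambda:V(H)\to\mathbb{Z}$ such that $|\lambda(u)-\lambda(v)|\le1$ for every edge $uv\in E(H)$. For vertices $x,y$ of $G$, $d_G(x,y)$ denotes their distance in $G$ (infinite if they lie in different components). For $P\subseteq V(G)$, a layering $\lambda$ of $G[P]$ is $G$-geodesic if $d_G(x,y)\ge|\lambda(x)-\lambda(y)|$ for all $x,y\in P$. -}

module Defs where

open import Data.Nat using (ℕ; zero; suc; _≤_)
open import Data.Fin using (Fin)
open import Data.Fin.Subset using (Subset; _∈_)
open import Data.Integer using (ℤ; _-_; ∣_∣)
open import Data.Product using (Σ; ∃; _×_)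
open import Relation.Nullary using (Dec; ¬_)
open import Relation.Binary.PropositionalEquality using (_≡_)

record Graph (n : ℕ) : Set₁ where
  field
    Adj     : Fin n → Fin n → Set
    adj?    : (u v : Fin n) → Dec (Adj u v)
    symm    : ∀ {u v} → Adj u v → Adj v u
    irrefl  : ∀ {u} → ¬ Adj u u
open Graph public

data Walk {n : ℕ} (G : Graph n) : Fin n → Fin n → Set where
  [] : ∀ {x} → Walk G x x
  _∷_ : ∀ {x y z} → Adj G x y → Walk G y z → Walk G x z

walkLength : ∀ {n} {G : Graph n} {x y : Fin n} → Walk G x y → ℕ
walkLength []      = 0
walkLength (_ ∷ w) = suc (walkLength w)

-- d_G(x,y) ≥ k : every x–y walk has length ≥ k (vacuous if x,y in different
-- components, where d_G(x,y) = ∞). Since d_G(x,y) is the minimum walk length,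
-- this is literally d_G(x,y) ≥ k.
DistAtLeast : ∀ {n} (G : Graph n) → Fin n → Fin n → ℕ → Set
DistAtLeast G x y k = (w : Walk G x y) → k ≤ walkLength w

VSubset : ℕ → Set
VSubset n = Subset n

PLabel : ∀ {n} → VSubset n → Set
PLabel {n} P = (x : Fin n) → x ∈ P → ℤ

IsLayeringOn : ∀ {n} (G : Graph n) (P : VSubset n) → PLabel P → Set
IsLayeringOn G P λ' =
  ∀ u v (pu : u ∈ P) (pv : v ∈ P) → Adj G u v → ∣ λ' u pu - λ' v pv ∣ ≤ 1

IsLayering : ∀ {n} (G : Graph n) → (Fin n → ℤ) → Set
IsLayering G μ = ∀ u v → Adj G u v → ∣ μ u - μ v ∣ ≤ 1

ExtendsToLayering : ∀ {n} (G : Graph n) (P : VSubset n) → PLabel P → Set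
ExtendsToLayering {n} G P λ' =
  Σ (Fin n → ℤ) λ μ → IsLayering G μ × (∀ x (px : x ∈ P) → μ x ≡ λ' x px)

IsGeodesic : ∀ {n} (G : Graph n) (P : VSubset n) → PLabel P → Set
IsGeodesic G P λ' =
  ∀ x y (px : x ∈ P) (py : y ∈ P) → DistAtLeast G x y ∣ λ' x px - λ' y py ∣

-- A layering changes by at most one along each edge, hence by at most the
-- length along each walk: the restriction of a layering is geodesic.
-- Conversely, for geodesic λ the McShane-type function
--   μ(v) = max over p ∈ P of λ(p) − d(p,v)
-- is a layering (the maximum of functions that change by at most one along
-- edges), and geodesicity says exactly that on P the maximum is attained at
-- p = v.  Instead of distances we maximise λ(p) − k over all p–v walks of
-- length k, and to cover components without vertices of P the maximum is
-- floored at min λ; walks longer than max λ − min λ then never contribute.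
module Submission where

open import Defs
open import Data.Nat using (ℕ)
open import Data.Product using (_×_)

open import Data.Nat as ℕ using (zero; suc; z≤n; s≤s)
import Data.Nat.Properties as ℕₚ
open import Data.Integer as ℤ using (ℤ; +_; -[1+_]; -_; _+_; _-_; ∣_∣; +≤+; -≤+)
import Data.Integer.Properties as ℤₚ
open import Data.Integer.Tactic.RingSolver using (solve-∀)
open import Data.Fin using (Fin; _≟_)
open import Data.Fin.Properties using (any?)
open import Data.Fin.Subset using (_∈_)
open import Data.Fin.Subset.Properties using (_∈?_)
open import Data.Vec.Properties.WithK using ([]=-irrelevant)
open import Data.List using (List; map; allFin; upTo)
open import Data.List.Membership.Propositional using () renaming (_∈_ to _∈ˡ_)
open import Data.List.Membership.Propositional.Properties
  using (∈-map⁺; ∈-allFin; ∈-upTo⁺; ∈-upTo⁻)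
open import Data.List.Relation.Unary.All using (lookup; tabulate)
open import Data.List.Relation.Unary.All.Properties using (map⁺)
import Data.List.Extrema ℤₚ.≤-totalOrder as Extrema
open import Data.Product using (Σ; ∃; _,_)
open import Data.Sum using (inj₁; inj₂)
open import Data.Empty using (⊥-elim)
open import Relation.Nullary using (Dec; yes; no)
open import Relation.Nullary.Decidable using (_×-dec_)
open import Relation.Binary.PropositionalEquality
  using (_≡_; refl; sym; trans; cong; cong₂; subst; subst₂)

i≤+∣i∣ : ∀ i → i ℤ.≤ + ∣ i ∣
i≤+∣i∣ (+ n)    = ℤₚ.≤-refl
i≤+∣i∣ -[1+ n ] = -≤+

[i-j]+[j-k]≡i-k : ∀ i j k → (i - j) + (j - k) ≡ i - k
[i-j]+[j-k]≡i-k = solve-∀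

∣i-k∣≤∣i-j∣+∣j-k∣ : ∀ i j k → ∣ i - k ∣ ℕ.≤ ∣ i - j ∣ ℕ.+ ∣ j - k ∣
∣i-k∣≤∣i-j∣+∣j-k∣ i j k = subst (ℕ._≤ ∣ i - j ∣ ℕ.+ ∣ j - k ∣)
  (cong ∣_∣ ([i-j]+[j-k]≡i-k i j k)) (ℤₚ.∣i+j∣≤∣i∣+∣j∣ (i - j) (j - k))

i-j≤k⇒i-k≤j : ∀ {i j k} → i - j ℤ.≤ k → i - k ℤ.≤ j
i-j≤k⇒i-k≤j {i} {j} {k} i-j≤k =
  subst₂ ℤ._≤_ ([i-j]+[j-k]≡i-k i j k) (cancel k j) (ℤₚ.+-monoˡ-≤ (j - k) i-j≤k)
  where
  cancel : ∀ k j → k + (j - k) ≡ j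
  cancel = solve-∀

∣i-j∣≤k⇒i-k≤j : ∀ i j k → ∣ i - j ∣ ℕ.≤ k → i - + k ℤ.≤ j
∣i-j∣≤k⇒i-k≤j i j k ∣i-j∣≤k = i-j≤k⇒i-k≤j {i} {j} (ℤₚ.≤-trans (i≤+∣i∣ (i - j)) (+≤+ ∣i-j∣≤k))

i≤j≤i+k⇒∣i-j∣≤k : ∀ {i j k} → i ℤ.≤ j → j ℤ.≤ i + + k → ∣ i - j ∣ ℕ.≤ k
i≤j≤i+k⇒∣i-j∣≤k {i} {j} {k} i≤j j≤i+k =
  ℤₚ.drop‿+≤+ (subst (ℤ._≤ + k) (sym (ℤₚ.∣-∣-≤ i≤j))
    (ℤₚ.≤-trans (ℤₚ.+-monoˡ-≤ (- i) j≤i+k) (ℤₚ.≤-reflexive (cancel i (+ k)))))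
  where
  cancel : ∀ i k → (i + k) - i ≡ k
  cancel = solve-∀

i≤j+k⇒j≤i+k⇒∣i-j∣≤k : ∀ {i j k} → i ℤ.≤ j + + k → j ℤ.≤ i + + k → ∣ i - j ∣ ℕ.≤ k
i≤j+k⇒j≤i+k⇒∣i-j∣≤k {i} {j} i≤j+k j≤i+k with ℤₚ.≤-total i j
... | inj₁ i≤j = i≤j≤i+k⇒∣i-j∣≤k i≤j j≤i+k
... | inj₂ j≤i = subst (ℕ._≤ _) (ℤₚ.∣i-j∣≡∣j-i∣ j i) (i≤j≤i+k⇒∣i-j∣≤k j≤i i≤j+k)

i-k≡i-[1+k]+1 : ∀ i k → i - + k ≡ (i - + suc k) + + 1
i-k≡i-[1+k]+1 i k = trans (shift i (+ k)) (cong (λ m → (i - m) + + 1) (sym (ℤₚ.pos-+ 1 k)))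
  where
  shift : ∀ i k → i - k ≡ (i - (+ 1 + k)) + + 1
  shift = solve-∀

module _ {A : Set} where

  ⨆ : ℤ → (A → ℤ) → List A → ℤ
  ⨆ b f xs = Extrema.max b (map f xs)

  ⨅ : ℤ → (A → ℤ) → List A → ℤ
  ⨅ b f xs = Extrema.min b (map f xs)

  b≤⨆ : ∀ b f xs → b ℤ.≤ ⨆ b f xs
  b≤⨆ b f xs = Extrema.⊥≤max b (map f xs)

  f≤⨆ : ∀ b f {xs x} → x ∈ˡ xs → f x ℤ.≤ ⨆ b f xs
  f≤⨆ b f {xs} x∈xs = lookup (Extrema.xs≤max b (map f xs)) (∈-map⁺ f x∈xs)

  ⨆≤ : ∀ {b f xs c} → b ℤ.≤ c → (∀ {x} → x ∈ˡ xs → f x ℤ.≤ c) → ⨆ b f xs ℤ.≤ c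
  ⨆≤ b≤c f≤c = Extrema.max≤v⁺ b≤c (map⁺ (tabulate f≤c))

  ⨅≤f : ∀ b f {xs x} → x ∈ˡ xs → ⨅ b f xs ℤ.≤ f x
  ⨅≤f b f {xs} x∈xs = lookup (Extrema.min≤xs b (map f xs)) (∈-map⁺ f x∈xs)

module _ {n} (G : Graph n) where

  Reach : ℕ → Fin n → Fin n → Set
  Reach zero    x y = x ≡ y
  Reach (suc k) x y = ∃ λ u → Adj G x u × Reach k u y

  reach? : ∀ k x y → Dec (Reach k x y)
  reach? zero    x y = x ≟ y
  reach? (suc k) x y = any? λ u → adj? G x u ×-dec reach? k u y

  reach-snoc : ∀ {k x u y} → Reach k x u → Adj G u y → Reach (suc k) x y
  reach-snoc {zero}  refl          u~y = _ , u~y , refl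
  reach-snoc {suc k} (w , x~w , r) u~y = w , x~w , reach-snoc r u~y

  reach⇒walk : ∀ {k x y} → Reach k x y → Σ (Walk G x y) λ w → walkLength w ≡ k
  reach⇒walk {zero}  refl          = [] , refl
  reach⇒walk {suc k} (u , x~u , r) =
    let w , ∣w∣≡k = reach⇒walk r in x~u ∷ w , cong suc ∣w∣≡k

∣μx-μy∣≤walkLength : ∀ {n} {G : Graph n} (μ : Fin n → ℤ) → IsLayering G μ →
                     ∀ {x y} (w : Walk G x y) → ∣ μ x - μ y ∣ ℕ.≤ walkLength w
∣μx-μy∣≤walkLength μ layering {x} [] =
  ℕₚ.≤-reflexive (cong ∣_∣ (ℤₚ.+-inverseʳ (μ x)))
∣μx-μy∣≤walkLength μ layering {x} (_∷_ {y = u} {z = y} x~u w) = ℕₚ.≤-trans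
  (∣i-k∣≤∣i-j∣+∣j-k∣ (μ x) (μ u) (μ y))
  (ℕₚ.+-mono-≤ (layering x u x~u) (∣μx-μy∣≤walkLength μ layering w))

extension⇒geodesic : ∀ {n} (G : Graph n) (P : VSubset n) (λ' : PLabel P) →
                     ExtendsToLayering G P λ' → IsGeodesic G P λ'
extension⇒geodesic G P λ' (μ , μ-layering , μ≡λ') x y x∈P y∈P w =
  subst (ℕ._≤ walkLength w) (cong₂ (λ a b → ∣ a - b ∣) (μ≡λ' x x∈P) (μ≡λ' y y∈P))
    (∣μx-μy∣≤walkLength μ μ-layering w)

module GeodesicExtension {n} (G : Graph n) (P : VSubset n) (λ' : PLabel P)
                         (geodesic : IsGeodesic G P λ') where

  open ℤₚ using (≤-trans)

  λ̃ : Fin n → ℤ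
  λ̃ p with p ∈? P
  ... | yes p∈P = λ' p p∈P
  ... | no  _   = + 0

  λ̃-∈ : ∀ {p} (p∈P : p ∈ P) → λ̃ p ≡ λ' p p∈P
  λ̃-∈ {p} p∈P with p ∈? P
  ... | yes p∈P′ = cong (λ' p) ([]=-irrelevant p∈P′ p∈P)
  ... | no  p∉P  = ⊥-elim (p∉P p∈P)

  λ̃-reach : ∀ {k p q} → p ∈ P → q ∈ P → Reach G k p q → λ̃ p - + k ℤ.≤ λ̃ q
  λ̃-reach {p = p} {q} p∈P q∈P r with reach⇒walk G r
  ... | w , refl = subst₂ (λ a b → a - + walkLength w ℤ.≤ b) (sym (λ̃-∈ p∈P)) (sym (λ̃-∈ q∈P))
    (∣i-j∣≤k⇒i-k≤j (λ' p p∈P) (λ' q q∈P) (walkLength w) (geodesic p q p∈P q∈P w))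

  lo hi : ℤ
  lo = ⨅ (+ 0) λ̃ (allFin n)
  hi = ⨆ (+ 0) λ̃ (allFin n)

  N : ℕ
  N = ∣ hi - lo ∣

  lo≤λ̃ : ∀ p → lo ℤ.≤ λ̃ p
  lo≤λ̃ p = ⨅≤f (+ 0) λ̃ (∈-allFin p)

  λ̃-N≤lo : ∀ p → λ̃ p - + N ℤ.≤ lo
  λ̃-N≤lo p = ≤-trans (ℤₚ.+-monoˡ-≤ (- + N) (f≤⨆ (+ 0) λ̃ (∈-allFin p)))
                     (∣i-j∣≤k⇒i-k≤j hi lo N ℕₚ.≤-refl)

  candidate : Fin n → ℕ → Fin n → ℤ
  candidate p k v with p ∈? P ×-dec reach? G k p v
  ... | yes _ = λ̃ p - + k
  ... | no  _ = lo

  candidate-reach : ∀ {p k v} → p ∈ P → Reach G k p v → candidate p k v ≡ λ̃ p - + k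
  candidate-reach {p} {k} {v} p∈P r with p ∈? P ×-dec reach? G k p v
  ... | yes _  = refl
  ... | no  ¬r = ⊥-elim (¬r (p∈P , r))

  candidate≤ : ∀ p k v {c} → lo ℤ.≤ c → (p ∈ P → Reach G k p v → λ̃ p - + k ℤ.≤ c) →
               candidate p k v ℤ.≤ c
  candidate≤ p k v lo≤c bound with p ∈? P ×-dec reach? G k p v
  ... | yes (p∈P , r) = bound p∈P r
  ... | no  _         = lo≤c

  μ-from : Fin n → Fin n → ℤ
  μ-from p v = ⨆ lo (λ k → candidate p k v) (upTo (suc N))

  μ : Fin n → ℤ
  μ v = ⨆ lo (λ p → μ-from p v) (allFin n)

  lo≤μ : ∀ v → lo ℤ.≤ μ v
  lo≤μ v = b≤⨆ lo (λ p → μ-from p v) (allFin n)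

  candidate≤μ : ∀ p {k} v → k ℕ.≤ N → candidate p k v ℤ.≤ μ v
  candidate≤μ p v k≤N = ≤-trans (f≤⨆ lo (λ k → candidate p k v) (∈-upTo⁺ (s≤s k≤N)))
                                (f≤⨆ lo (λ p → μ-from p v) (∈-allFin p))

  μ≤ : ∀ v {c} → lo ℤ.≤ c → (∀ p k → k ℕ.≤ N → candidate p k v ℤ.≤ c) → μ v ℤ.≤ c
  μ≤ v lo≤c candidate≤c =
    ⨆≤ {xs = allFin n} lo≤c λ {p} _ → ⨆≤ lo≤c λ {k} k∈ → candidate≤c p k (ℕₚ.≤-pred (∈-upTo⁻ k∈))

  μ≡λ̃ : ∀ {v} → v ∈ P → μ v ≡ λ̃ v
  μ≡λ̃ {v} v∈P = ℤₚ.≤-antisym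
    (μ≤ v (lo≤λ̃ v) λ p k _ → candidate≤ p k v (lo≤λ̃ v) λ p∈P r → λ̃-reach p∈P v∈P r)
    (subst (ℤ._≤ μ v) (trans (candidate-reach v∈P refl) (ℤₚ.+-identityʳ (λ̃ v)))
      (candidate≤μ v v z≤n))

  μ-edge : ∀ {u v} → Adj G u v → μ u ℤ.≤ μ v + + 1
  μ-edge {u} {v} u~v = μ≤ u lo≤μv+1 λ p k k≤N → candidate≤ p k u lo≤μv+1 (via p k≤N)
    where
    lo≤μv+1 : lo ℤ.≤ μ v + + 1
    lo≤μv+1 = ≤-trans (lo≤μ v) (ℤₚ.i≤i+j (μ v) (+ 1))
    via : ∀ p {k} → k ℕ.≤ N → p ∈ P → Reach G k p u → λ̃ p - + k ℤ.≤ μ v + + 1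
    via p {k} k≤N p∈P r with ℕₚ.m≤n⇒m<n∨m≡n k≤N
    ... | inj₁ k<N = begin
      λ̃ p - + k                   ≡⟨ i-k≡i-[1+k]+1 (λ̃ p) k ⟩
      (λ̃ p - + suc k) + + 1       ≡⟨ cong (_+ + 1) (candidate-reach p∈P (reach-snoc G r u~v)) ⟨
      candidate p (suc k) v + + 1 ≤⟨ ℤₚ.+-monoˡ-≤ (+ 1) (candidate≤μ p v k<N) ⟩
      μ v + + 1                   ∎
      where open ℤₚ.≤-Reasoning
    ... | inj₂ refl = ≤-trans (λ̃-N≤lo p) lo≤μv+1

  extension : ExtendsToLayering G P λ'
  extension = μ , layering , λ x x∈P → trans (μ≡λ̃ x∈P) (λ̃-∈ x∈P)
    where
    layering : IsLayering G μ
    layering u v u~v = i≤j+k⇒j≤i+k⇒∣i-j∣≤k (μ-edge u~v) (μ-edge (symm G u~v))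

lemma3 : ∀ {n} (G : Graph n) (P : VSubset n) (λ' : PLabel P) →
    IsLayeringOn G P λ' →
    (ExtendsToLayering G P λ' → IsGeodesic G P λ') × (IsGeodesic G P λ' → ExtendsToLayering G P λ')
lemma3 G P λ' _ = extension⇒geodesic G P λ' , GeodesicExtension.extension G P λ'
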